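{- Let $\approx$ be an SCER on $\Sigma^*$ and $T$ a string. If $C\in\mathsf{Cov}_{\approx}(T)$ and $C'\in\mathsf{Cov}_{\approx}(C)$, then $C'\in\mathsf{Cov}_{\approx}(T)$.
   Context: $\Sigma^*$ is the set of strings over an alphabet $\Sigma$. For a string $T$, $|T|$ is its length, $T[i:j]$ the substring from position $i$ to $j$, $T[:j]=T[1:j]$, $T[i:]=T[i:|T|]$. An SCER is an equivalence relation $\approx$ on $\Sigma^*$ such that $X\approx Y$ implies $|X|=|Y|$ and $X[i:j]\approx Y[i:j]$ for all $1\le i\le j\le|X|$. $\mathsf{Occ}_{P,T}=\{\,i : 1\le i\le |T|-|P|+1,\ P\approx T[i:i+|P|-1]\,\}$. A string $C$ of length $c$ is a $\approx$-cover of $T$ of length $n$ if there are $x_1,\dots,x_m\in\mathsf{Occ}_{C,T}$ with $x_1=1$, $x_m=n-c+1$ and $x_{i-1}<x_i\le x_{i-1}+c$ for all $1<i\le m$; $\mathsf{Cov}_\approx(T)$ is the set of all $\approx$-covers of $T$. -}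

module Defs where

open import Level using (Level; _⊔_; suc)
open import Data.Nat using (ℕ; _+_; _∸_; _≤_; _<_)
open import Data.List using (List; length; take; drop)
open import Data.List.NonEmpty using (List⁺; _∷_; head; last; toList)
open import Data.List.Relation.Unary.All using (All)
open import Data.List.Relation.Unary.Linked using (Linked)
open import Data.Product using (Σ; _×_)
open import Relation.Binary.Core using (Rel)
open import Relation.Binary.Structures using (IsEquivalence)
open import Relation.Binary.PropositionalEquality using (_≡_)

-- 1-indexed substring T[i:j] (characters at positions i..j inclusive).
-- For j = i - 1 this is the empty string.
sub : ∀ {a} {A : Set a} → List A → ℕ → ℕ → List A
sub T i j = take (1 + j ∸ i) (drop (i ∸ 1) T)

record IsSCER {a ℓ} {Σ : Set a} (_≈_ : Rel (List Σ) ℓ) : Set (a ⊔ ℓ) where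
  field
    isEquivalence : IsEquivalence _≈_
    length-≈      : ∀ {X Y} → X ≈ Y → length X ≡ length Y
    sub-≈         : ∀ {X Y} → X ≈ Y → ∀ i j → 1 ≤ i → i ≤ j → j ≤ length X →
                    sub X i j ≈ sub Y i j

-- i ∈ Occ_{P,T}: 1 ≤ i ≤ |T| - |P| + 1 and P ≈ T[i : i+|P|-1]
-- (the upper bound is written i + |P| ≤ |T| + 1 to avoid truncated subtraction)
InOcc : ∀ {a ℓ} {Σ : Set a} → Rel (List Σ) ℓ → List Σ → List Σ → ℕ → Set ℓ
InOcc _≈_ P T i = (1 ≤ i) × (i + length P ≤ length T + 1) × (P ≈ sub T i (i + length P ∸ 1))

IsCover : ∀ {a ℓ} {Σ : Set a} → Rel (List Σ) ℓ → List Σ → List Σ → Set ℓ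
IsCover _≈_ C T =
  Σ (List⁺ ℕ) λ xs →
    All (InOcc _≈_ C T) (toList xs)
    × head xs ≡ 1
    × last xs + length C ≡ length T + 1
    × Linked (λ x y → x < y × y ≤ x + length C) (toList xs)

-- Occurrences compose: if C′ ≈-occurs in C at j and C ≈-occurs in T at i,
-- then C′ ≈-occurs in T at i + j - 1, because an SCER is closed under taking
-- equal windows of equivalent strings.  A cover is a chain of occurrences whose
-- consecutive gaps are at most the length of the covering string.  Walking along
-- the occurrences of C in T, we translate the chain of C′ in C to each of them in
-- turn and splice it onto the chain built so far, skipping the translated
-- positions that are already passed.  No gap exceeds |C′|: consecutive
-- occurrences of C overlap or touch, and the chain of C′ reaches the end of C.
module Submission where

open import Defs
open import Level using (0ℓ)
open import Data.List using (List; []; _∷_; length; take; drop)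
open import Data.List.Properties using (take-drop; take-take; drop-drop)
open import Data.List.NonEmpty using (_∷_; last)
import Data.List.Base as List
open import Data.List.Relation.Unary.All using (All; []; _∷_)
open import Data.List.Relation.Unary.Linked using (Linked; [-]; _∷_)
open import Data.Nat using (ℕ; zero; suc; _+_; _≤_; _<_; _⊓_; z≤n; s≤s; _≤?_)
open import Data.Nat.Properties
open import Data.Product using (∃-syntax; _×_; _,_; proj₁)
open import Relation.Binary.Bundles using (Setoid)
open import Relation.Binary.Core using (Rel)
open import Relation.Binary.Structures using (IsEquivalence)
open import Relation.Binary.PropositionalEquality using (_≡_; refl; sym; trans; cong; subst; module ≡-Reasoning)
open import Relation.Nullary using (yes; no; contradiction)

last-∷ : ∀ {a} {A : Set a} (x y : A) ys → last (x ∷ y ∷ ys) ≡ last (y ∷ ys)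
last-∷ x y ys with List.initLast ys
... | []          = refl
... | _ List.∷ʳ′ _ = refl

module _ {a} {A : Set a} where

  sub-window : ∀ (X : List A) j k → sub X (suc j) (j + k) ≡ take k (drop j X)
  sub-window X j k = cong (λ n → take n (drop j X)) (m+n∸m≡n j k)

  take-drop-take : ∀ m n L (U : List A) → m + n ≤ L →
                   take n (drop m (take L U)) ≡ take n (drop m U)
  take-drop-take m n L U m+n≤L = begin
    take n (drop m (take L U))       ≡⟨ take-drop n m (take L U) ⟩
    drop m (take (m + n) (take L U)) ≡⟨ cong (drop m) (take-take (m + n) L U) ⟩
    drop m (take ((m + n) ⊓ L) U)    ≡⟨ cong (λ k → drop m (take k U)) (m≤n⇒m⊓n≡m m+n≤L) ⟩
    drop m (take (m + n) U)          ≡⟨ take-drop n m U ⟨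
    take n (drop m U)                ∎
    where open ≡-Reasoning

module Occurrence {a ℓ} {A : Set a} {_≈_ : Rel (List A) ℓ} (scer : IsSCER _≈_) where
  open IsSCER scer

  ≈-setoid : Setoid a ℓ
  ≈-setoid = record { isEquivalence = isEquivalence }

  open IsEquivalence isEquivalence using () renaming (refl to ≈-refl)
  open import Relation.Binary.Reasoning.Setoid ≈-setoid

  window-≈ : ∀ {X W} j k → X ≈ W → j + k ≤ length X →
             take k (drop j X) ≈ take k (drop j W)
  window-≈ j zero    X≈W _    = ≈-refl
  window-≈ {X} {W} j (suc k) X≈W fits = begin
    take (suc k) (drop j X) ≡⟨ sub-window X j (suc k) ⟨
    sub X (suc j) (j + suc k) ≈⟨ sub-≈ X≈W (suc j) (j + suc k) (s≤s z≤n) (m<m+n j (s≤s z≤n)) fits ⟩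
    sub W (suc j) (j + suc k) ≡⟨ sub-window W j (suc k) ⟩
    take (suc k) (drop j W) ∎

  occurrence-trans : ∀ {T C C′ d y} → InOcc _≈_ C T (suc d) → InOcc _≈_ C′ C y →
                     InOcc _≈_ C′ T (d + y)
  occurrence-trans {y = zero} _ (() , _)
  occurrence-trans {T} {C} {C′} {d} {suc j} (_ , C-fits , C≈) (_ , C′-fits , C′≈) =
    subst (InOcc _≈_ C′ T) (sym (+-suc d j)) (s≤s z≤n , fits , C′≈T)
    where
    c c′ : ℕ
    c = length C
    c′ = length C′

    j+c′≤c : j + c′ ≤ c
    j+c′≤c = ≤-pred (≤-trans C′-fits (≤-reflexive (+-comm c 1)))

    fits : suc (d + j) + c′ ≤ length T + 1
    fits = ≤-trans (≤-reflexive (cong suc (+-assoc d j c′)))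
                   (≤-trans (s≤s (+-monoʳ-≤ d j+c′≤c)) C-fits)

    -- InOcc's window sub T i (i + c ∸ 1) with i = suc d reduces to sub T (suc d) (d + c).
    C′≈T : C′ ≈ sub T (suc (d + j)) (d + j + c′)
    C′≈T = begin
      C′                                       ≈⟨ C′≈ ⟩
      sub C (suc j) (j + c′)                   ≡⟨ sub-window C j c′ ⟩
      take c′ (drop j C)                       ≈⟨ window-≈ j c′ C≈ j+c′≤c ⟩
      take c′ (drop j (sub T (suc d) (d + c))) ≡⟨ cong (λ W → take c′ (drop j W)) (sub-window T d c) ⟩
      take c′ (drop j (take c (drop d T)))     ≡⟨ take-drop-take j c′ c (drop d T) j+c′≤c ⟩
      take c′ (drop j (drop d T))              ≡⟨ cong (take c′) (drop-drop d j T) ⟩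
      take c′ (drop (d + j) T)                 ≡⟨ sub-window T (d + j) c′ ⟨
      sub T (suc (d + j)) (d + j + c′)         ∎

Step : ℕ → Rel ℕ 0ℓ
Step c x y = x < y × y ≤ x + c

data Chain {ℓ} (P : ℕ → Set ℓ) (c : ℕ) : ℕ → ℕ → Set ℓ where
  end  : ∀ {x} → P x → Chain P c x x
  step : ∀ {x y e} → P x → Step c x y → Chain P c y e → Chain P c x e

module _ {ℓ} {P : ℕ → Set ℓ} {c : ℕ} where

  chain-start : ∀ {x e} → Chain P c x e → P x
  chain-start (end p)      = p
  chain-start (step p _ _) = p

  chain-end : ∀ {x e} → Chain P c x e → P e
  chain-end (end p)          = p
  chain-end (step _ _ chain) = chain-end chain

  _++⟨_⟩_ : ∀ {x l y e} → Chain P c x l → Step c l y → Chain P c y e → Chain P c x e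
  end p             ++⟨ l→y ⟩ rest = step p l→y rest
  step p x→z chain ++⟨ l→y ⟩ rest = step p x→z (chain ++⟨ l→y ⟩ rest)

  linked⇒chain : ∀ x xs → All P (x ∷ xs) → Linked (Step c) (x ∷ xs) →
                 Chain P c x (last (x ∷ xs))
  linked⇒chain x []       (p ∷ []) _              = end p
  linked⇒chain x (y ∷ ys) (p ∷ ps) (x→y ∷ linked) =
    subst (Chain P c x) (sym (last-∷ x y ys)) (step p x→y (linked⇒chain y ys ps linked))

  chain⇒linked : ∀ {x e} → Chain P c x e →
                 ∃[ xs ] All P (x ∷ xs) × Linked (Step c) (x ∷ xs) × last (x ∷ xs) ≡ e
  chain⇒linked (end p) = [] , p ∷ [] , [-] , refl
  chain⇒linked {x} (step {y = y} p x→y chain) with chain⇒linked chain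
  ... | ys , ps , linked , last≡e =
    y ∷ ys , p ∷ ps , x→y ∷ linked , trans (last-∷ x y ys) last≡e

Step-shift : ∀ {c x y} d → Step c x y → Step c (d + x) (d + y)
Step-shift {c} {x} d (x<y , y≤x+c) =
  +-monoʳ-< d x<y , ≤-trans (+-monoʳ-≤ d y≤x+c) (≤-reflexive (sym (+-assoc d x c)))

module _ {ℓ ℓ′} {P : ℕ → Set ℓ} {Q : ℕ → Set ℓ′} {c : ℕ} where

  shift : ∀ {d x e} → (∀ {y} → P y → Q (d + y)) → Chain P c x e → Chain Q c (d + x) (d + e)
  shift f (end p)                = end (f p)
  shift {d} f (step p x→y chain) = step (f p) (Step-shift d x→y) (shift f chain)

  splice : ∀ {d x l y e} → (∀ {z} → P z → Q (d + z)) →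
           Chain Q c x l → Chain P c y e → d + y ≤ l + c → l < d + e → Chain Q c x (d + e)
  splice f acc (end p) d+y≤l+c l<d+e = acc ++⟨ l<d+e , d+y≤l+c ⟩ end (f p)
  splice {d} {l = l} {y} f acc inner@(step {y = z} p (_ , z≤y+c) rest) d+y≤l+c l<d+e with d + y ≤? l
  ... | yes d+y≤l = splice f acc rest d+z≤l+c l<d+e
    where
    d+z≤l+c : d + z ≤ l + c
    d+z≤l+c = ≤-trans (+-monoʳ-≤ d z≤y+c)
                      (≤-trans (≤-reflexive (sym (+-assoc d y c))) (+-monoˡ-≤ c d+y≤l))
  ... | no d+y≰l = acc ++⟨ ≰⇒> d+y≰l , d+y≤l+c ⟩ shift f inner

module _ {ℓ ℓ′ ℓ″} {O : ℕ → Set ℓ} {P : ℕ → Set ℓ′} {Q : ℕ → Set ℓ″} {c c′ e : ℕ}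
         (transport : ∀ {d y} → O (suc d) → P y → Q (d + y))
         (inner : Chain P c′ 1 e) (c+1≤e+c′ : c + 1 ≤ e + c′) where

  merge : ∀ {x d D} → Chain O c (suc d) (suc D) → Chain Q c′ x (d + e) → Chain Q c′ x (D + e)
  merge (end _) acc = acc
  merge {d = d} (step {y = suc d₂} _ (s≤s d<d₂ , s≤s d₂≤d+c) outer) acc =
    merge outer (splice (transport (chain-start outer)) acc inner fits (+-monoˡ-< e d<d₂))
    where
    fits : d₂ + 1 ≤ d + e + c′
    fits = ≤-trans (+-monoˡ-≤ 1 d₂≤d+c)
             (≤-trans (≤-reflexive (+-assoc d c 1))
               (≤-trans (+-monoʳ-≤ d c+1≤e+c′) (≤-reflexive (sym (+-assoc d e c′)))))

module _ {a ℓ} {A : Set a} {_≈_ : Rel (List A) ℓ} {C T : List A} where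

  cover⇒chain : IsCover _≈_ C T →
                ∃[ e ] Chain (InOcc _≈_ C T) (length C) 1 e × e + length C ≡ length T + 1
  cover⇒chain (x ∷ xs , occ , refl , last+c≡n+1 , linked) =
    last (x ∷ xs) , linked⇒chain x xs occ linked , last+c≡n+1

  chain⇒cover : ∀ {e} → Chain (InOcc _≈_ C T) (length C) 1 e → e + length C ≡ length T + 1 →
                IsCover _≈_ C T
  chain⇒cover chain e+c≡n+1 with chain⇒linked chain
  ... | xs , occ , linked , refl = 1 ∷ xs , occ , refl , e+c≡n+1 , linked

lemma5 : ∀ {a ℓ} {Σ : Set a} (_≈_ : Rel (List Σ) ℓ) → IsSCER _≈_ →
         ∀ (T C C′ : List Σ) → IsCover _≈_ C T → IsCover _≈_ C′ C → IsCover _≈_ C′ T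
lemma5 _≈_ scer T C C′ C-covers-T C′-covers-C
  with cover⇒chain {_≈_ = _≈_} C-covers-T | cover⇒chain {_≈_ = _≈_} C′-covers-C
... | zero , outer , _ | _ = contradiction (proj₁ (chain-end outer)) λ ()
... | suc D , outer , D+1+c≡n+1 | e , inner , e+c′≡c+1 =
  chain⇒cover {_≈_ = _≈_}
    (merge compose inner (≤-reflexive (sym e+c′≡c+1)) outer (shift (compose (chain-start outer)) inner))
    end-fits
  where
  open ≡-Reasoning

  compose : ∀ {d y} → InOcc _≈_ C T (suc d) → InOcc _≈_ C′ C y → InOcc _≈_ C′ T (d + y)
  compose = Occurrence.occurrence-trans scer

  c c′ : ℕ
  c = length C
  c′ = length C′

  end-fits : D + e + c′ ≡ length T + 1
  end-fits = begin
    D + e + c′   ≡⟨ +-assoc D e c′ ⟩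
    D + (e + c′) ≡⟨ cong (D +_) e+c′≡c+1 ⟩
    D + (c + 1)  ≡⟨ cong (D +_) (+-comm c 1) ⟩
    D + suc c    ≡⟨ +-suc D c ⟩
    suc D + c    ≡⟨ D+1+c≡n+1 ⟩
    length T + 1 ∎
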